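{- Let $i\geq 1$ and $m\geq 1$ be integers. Let $G_m$ be obtained from the cycle $v_0v_1\ldots v_{2m-1}v_0$ of length $2m$ by adding $i$ flags at the vertex $v_{2h}$ for each $0\leq h\leq m-1$. Then $G_m$ is $(i,i)$-critical.
   Context: Multigraphs are finite without loops (for $m=1$ the cycle is a pair of parallel edges). A flag at a vertex $w$ is a new vertex $u$ joined to $w$ by exactly two parallel edges and incident with no other edges. A 2-fold cover of a multigraph $G$ is a pair $(L,\mathcal H)$ where $\mathcal H$ is a graph and $L$ assigns to each $v\in V(G)$ a 2-element set $L(v)=\{p(v),r(v)\}$ such that the sets $L(v)$ partition $V(\mathcal H)$, $p(v)r(v)\in E(\mathcal H)$, edges of $\mathcal H$ between $L(u)$ and $L(v)$ ($u\ne v$) exist only if $uv\in E(G)$, and if $u,v$ are joined by $k\ge1$ edges then $\mathcal H[L(u),L(v)]$ is a union of at most $k$ perfect matchings between $L(u)$ and $L(v)$. An $\mathcal H$-map is a function $\phi$ with $\phi(v)\in L(v)$; $\mathcal H_\phi$ is the subgraph induced by $\phi(V(G))$. An $(i,i)$-coloring is an $\mathcal H$-map $\phi$ such that every vertex of $\mathcal H_\phi$ has degree at most $i$ in $\mathcal H_\phi$. $G$ is $(i,i)$-critical if some 2-fold cover of $G$ has no $(i,i)$-coloring while every 2-fold cover of each proper subgraph of $G$ has one. -}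

module Defs where

open import Data.Nat using (ℕ; zero; suc; _+_; _*_; _∸_; _≤_; _<_; NonZero)
open import Data.Nat.Properties using (+-comm; _<?_)
open import Data.Nat.DivMod using (_/_; _%_)
open import Data.Bool using (Bool; true; false; _∧_; _∨_; not; if_then_else_)
open import Data.Bool.Properties using () renaming (_≟_ to _≟ᵇ_)
open import Data.Fin using (Fin; toℕ) renaming (_≟_ to _≟ᶠ_)
open import Data.List using (List; []; _∷_; allFin)
open import Data.Product using (Σ; _×_; _,_; ∃)
open import Data.Empty using (⊥-elim)
open import Relation.Nullary using (¬_; Dec; yes; no; does)
open import Relation.Binary.PropositionalEquality using (_≡_; _≢_; refl; sym)

record MultiGraph : Set where
  field
    n        : ℕ
    mult     : Fin n → Fin n → ℕ
    mult-sym : ∀ u v → mult u v ≡ mult v u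
    loopless : ∀ v → mult v v ≡ 0
open MultiGraph public

boolToℕ : Bool → ℕ
boolToℕ true  = 1
boolToℕ false = 0

_==_ : Bool → Bool → Bool
a == b = does (a ≟ᵇ b)

-- V(H) = Fin n × Bool, with L(v) = {(v,false),(v,true)},
-- p(v) = (v,false), r(v) = (v,true).  E u a v b says whether (u,a)(v,b)
-- is an edge of the (simple) graph H.
-- The two perfect matchings between L(u) and L(v) are the "straight" one
-- {(u,a)(v,a)} and the "crossed" one {(u,a)(v,not a)}; a union of at most
-- k of them is given by choosing s (use straight) and c (use crossed) with
-- boolToℕ s + boolToℕ c ≤ k.

record Cover (G : MultiGraph) : Set where
  field
    E        : Fin (n G) → Bool → Fin (n G) → Bool → Bool
    E-sym    : ∀ u a v b → E u a v b ≡ E v b u a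
    -- inside L(v): no loops, and p(v)r(v) is an edge
    E-inside : ∀ v a b → E v a v b ≡ not (a == b)
    E-between : ∀ u v → u ≢ v →
      Σ Bool λ s → Σ Bool λ c →
        (boolToℕ s + boolToℕ c ≤ mult G u v) ×
        (∀ a b → E u a v b ≡ ((s ∧ (a == b)) ∨ (c ∧ not (a == b))))
open Cover public

countTrue : List Bool → ℕ
countTrue []       = 0
countTrue (b ∷ bs) = boolToℕ b + countTrue bs

mapL : {A B : Set} → (A → B) → List A → List B
mapL f []       = []
mapL f (x ∷ xs) = f x ∷ mapL f xs

-- An H-map is φ : Fin n → Bool (φ v ∈ L(v) is (v , φ v)).
-- Degree of (v , φ v) in H_φ (the subgraph of H induced by the chosen vertices).
degφ : {G : MultiGraph} → Cover G → (Fin (n G) → Bool) → Fin (n G) → ℕ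
degφ {G} C φ v =
  countTrue (mapL (λ w → not (does (w ≟ᶠ v)) ∧ E C v (φ v) w (φ w)) (allFin (n G)))

IsIIColoring : (i : ℕ) {G : MultiGraph} → Cover G → (Fin (n G) → Bool) → Set
IsIIColoring i C φ = ∀ v → degφ C φ v ≤ i

HasIIColoring : (i : ℕ) {G : MultiGraph} → Cover G → Set
HasIIColoring i {G} C = Σ (Fin (n G) → Bool) λ φ → IsIIColoring i C φ

record Subgraph (G : MultiGraph) : Set where
  field
    H       : MultiGraph
    emb     : Fin (n H) → Fin (n G)
    emb-inj : ∀ a b → emb a ≡ emb b → a ≡ b
    mult-≤  : ∀ a b → mult H a b ≤ mult G (emb a) (emb b)
open Subgraph public

IsProper : {G : MultiGraph} → Subgraph G → Set
IsProper {G} S =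
  ¬ ((∀ v → ∃ λ a → emb S a ≡ v) ×
     (∀ a b → mult (H S) a b ≡ mult G (emb S a) (emb S b)))

IICritical : ℕ → MultiGraph → Set
IICritical i G =
  (Σ (Cover G) λ C → ¬ HasIIColoring i C) ×
  (∀ (S : Subgraph G) → IsProper S → ∀ (C : Cover (H S)) → HasIIColoring i C)

-- Vertices 0 .. 2m-1 are the cycle vertices v_0 .. v_{2m-1};
-- vertices 2m + k (0 ≤ k < m*i) are the flags, flag k attached at
-- v_{2 (k / i)} (so each v_{2h} receives the i flags k = h*i, ..., h*i+i-1).

isTrue : {P : Set} → Dec P → Bool
isTrue d = does d

-- directed contribution: cycle edge v_a v_{a+1 mod 2m} counts 1 from a to b,
-- cycle vertex a with a flag b attached at a counts 2 (two parallel edges)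
baseG : (i m : ℕ) .{{_ : NonZero i}} → ℕ → ℕ → ℕ
baseG i m a b =
  (if isTrue (a <? 2 * m) ∧ isTrue (b <? 2 * m)
      ∧ (isTrue (b Data.Nat.≟ suc a)
         ∨ (isTrue (suc a Data.Nat.≟ 2 * m) ∧ isTrue (b Data.Nat.≟ 0)))
   then 1 else 0)
  + (if isTrue (a <? 2 * m) ∧ not (isTrue (b <? 2 * m))
        ∧ isTrue (a Data.Nat.≟ 2 * ((b ∸ 2 * m) / i))
     then 2 else 0)

-- number of edges between vertices a and b of G_m
-- (the a ≡ b guard only makes looplessness definitional; for m ≥ 1 the
-- formula baseG gives no loops anyway)
multGm : (i m : ℕ) .{{_ : NonZero i}} → Fin (2 * m + m * i) → Fin (2 * m + m * i) → ℕ
multGm i m x y with x ≟ᶠ y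
... | yes _ = 0
... | no  _ = baseG i m (toℕ x) (toℕ y) + baseG i m (toℕ y) (toℕ x)

multGm-sym : (i m : ℕ) .{{_ : NonZero i}} → ∀ x y → multGm i m x y ≡ multGm i m y x
multGm-sym i m x y with x ≟ᶠ y | y ≟ᶠ x
... | yes _ | yes _ = refl
... | no  _ | no  _ = +-comm (baseG i m (toℕ x) (toℕ y)) (baseG i m (toℕ y) (toℕ x))
... | yes p | no  q = ⊥-elim (q (sym p))
... | no  p | yes q = ⊥-elim (p (sym q))

multGm-loopless : (i m : ℕ) .{{_ : NonZero i}} → ∀ x → multGm i m x x ≡ 0
multGm-loopless i m x with x ≟ᶠ x
... | yes _ = refl
... | no  p = ⊥-elim (p refl)

Gm : (i m : ℕ) .{{_ : NonZero i}} → MultiGraph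
Gm i m = record
  { n        = 2 * m + m * i
  ; mult     = multGm i m
  ; mult-sym = multGm-sym i m
  ; loopless = multGm-loopless i m
  }

module Submission where

-- Uncolourability: a "bad" cover using both matchings over double edges and a
-- single matching over simple edges (straight on v_0 v_1, crossed elsewhere).
-- Flags saturate every even vertex, so no cycle edge may carry a conflict; for
-- m = 1 the double edge v_0 v_1 always does, and for m ≥ 2 the single
-- matchings give v_0 and v_1 equal and different colours.
--
-- Colourability of proper subgraphs: a cover of a proper subgraph extends to a
-- cover of G_m that is deficient (fewer matchings than edges) over some pair,
-- and colourings restrict back.  A deficient cover is coloured greedily along
-- the cycle, flipping the colours from a well-chosen position on so that the
-- single possible cycle conflict lands on the deficient edge, or next to a
-- flag that carries a single matching; flags avoid their attachment vertex.

open import Defs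
open import Data.Nat using (ℕ; zero; suc; _+_; _*_; _∸_; _≤_; _<_; _≤ᵇ_; z≤n; s≤s; pred; >-nonZero)
open import Data.Nat.Properties
open import Data.Nat.DivMod
open import Data.Nat.Divisibility using (divides)
open import Algebra.Properties.CommutativeSemigroup +-commutativeSemigroup
  using () renaming (interchange to +-interchange)
open import Data.Bool using (Bool; true; false; _∧_; _∨_; not; if_then_else_; T)
open import Data.Bool.Properties using (¬-not)
open import Data.Unit using (tt)
open import Data.Fin using (Fin; zero; suc; toℕ; fromℕ<) renaming (_≟_ to _≟ᶠ_)
open import Data.Fin.Properties
  using (toℕ-injective; toℕ<n; toℕ-fromℕ<; any?; all?; ¬∀⟶∃¬)
  renaming (suc-injective to fsuc-injective; 0≢1+n to fzero≢fsuc)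
open import Data.List using (allFin; tabulate)
open import Data.Product using (Σ; _×_; _,_; ∃; proj₁; proj₂)
open import Data.Sum using (_⊎_; inj₁; inj₂; [_,_]′)
open import Data.Empty using (⊥; ⊥-elim)
open import Relation.Nullary using (¬_; Dec; yes; no; does)
open import Relation.Nullary.Decidable using (dec-true; dec-false)
open import Relation.Binary.PropositionalEquality

true≢false : true ≢ false
true≢false ()

does-false : ∀ {P : Set} (d : Dec P) → does d ≡ false → ¬ P
does-false (no ¬p) _ = ¬p

∧-true : ∀ {a b} → a ≡ true → b ≡ true → a ∧ b ≡ true
∧-true refl refl = refl

∧-true-left : ∀ {a b} → a ∧ b ≡ true → a ≡ true
∧-true-left {true} _ = refl

∧-true-right : ∀ {a b} → a ∧ b ≡ true → b ≡ true
∧-true-right {true} p = p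

==-sym : ∀ a b → (a == b) ≡ (b == a)
==-sym false false = refl
==-sym false true  = refl
==-sym true  false = refl
==-sym true  true  = refl

≤ᵇ-true : ∀ {a b} → (a ≤ᵇ b) ≡ true → a ≤ b
≤ᵇ-true {a} {b} a≤b = ≤ᵇ⇒≤ a b (subst T (sym a≤b) tt)

≤ᵇ-false : ∀ {a b} → (a ≤ᵇ b) ≡ false → b < a
≤ᵇ-false {a} {b} a≰b = ≰⇒> (λ a≤b → subst T a≰b (≤⇒≤ᵇ a≤b))

even-or-odd : ∀ a → (Σ ℕ λ h → a ≡ 2 * h) ⊎ (Σ ℕ λ h → a ≡ suc (2 * h))
even-or-odd zero = inj₁ (0 , refl)
even-or-odd (suc a) with even-or-odd a
... | inj₁ (h , a≡2h)  = inj₂ (h , cong suc a≡2h)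
... | inj₂ (h , a≡2h+1) = inj₁ (suc h , trans (cong suc a≡2h+1) (sym (*-suc 2 h)))

matching : Bool → Bool → Bool → Bool → Bool
matching s c a b = (s ∧ (a == b)) ∨ (c ∧ not (a == b))

matching-straight-bit : ∀ s c → matching s c false false ≡ s
matching-straight-bit false false = refl
matching-straight-bit false true  = refl
matching-straight-bit true  false = refl
matching-straight-bit true  true  = refl

matching-crossed-bit : ∀ s c → matching s c false true ≡ c
matching-crossed-bit false false = refl
matching-crossed-bit false true  = refl
matching-crossed-bit true  false = refl
matching-crossed-bit true  true  = refl

matching-sym : ∀ s c a b → matching s c a b ≡ matching s c b a
matching-sym s c a b = cong (λ e → (s ∧ e) ∨ (c ∧ not e)) (==-sym a b)

matching-flip-both : ∀ s c a b → matching s c (not a) (not b) ≡ matching s c a b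
matching-flip-both s c false false = refl
matching-flip-both s c false true  = refl
matching-flip-both s c true  false = refl
matching-flip-both s c true  true  = refl

matching-flip-swap : ∀ s c a b → matching s c (not a) b ≡ matching s c a (not b)
matching-flip-swap s c false false = refl
matching-flip-swap s c false true  = refl
matching-flip-swap s c true  false = refl
matching-flip-swap s c true  true  = refl

matching-full : ∀ a b → matching true true a b ≡ true
matching-full false false = refl
matching-full false true  = refl
matching-full true  false = refl
matching-full true  true  = refl

-- If not both matchings are present, (u,a) has at most one neighbour in L(v):
-- the colour 'matching s c a false' of v avoids it, and recolouring v turns
-- an edge into a non-edge.
matching-avoid : ∀ s c a → s ∧ c ≡ false → matching s c a (matching s c a false) ≡ false
matching-avoid false false a     _ = refl
matching-avoid false true  false _ = refl
matching-avoid false true  true  _ = refl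
matching-avoid true  false false _ = refl
matching-avoid true  false true  _ = refl

matching-flip-one : ∀ s c a b → s ∧ c ≡ false → matching s c a b ≡ true →
  matching s c a (not b) ≡ false
matching-flip-one false true  false true  _ _ = refl
matching-flip-one false true  true  false _ _ = refl
matching-flip-one true  false false false _ _ = refl
matching-flip-one true  false true  true  _ _ = refl
matching-flip-one false false a     b     _ ()
matching-flip-one false true  false false _ ()
matching-flip-one false true  true  true  _ ()
matching-flip-one true  false false true  _ ()
matching-flip-one true  false true  false _ ()

crossed-absent⇒equal : ∀ a b → matching false true a b ≡ false → a ≡ b
crossed-absent⇒equal false false _ = refl
crossed-absent⇒equal true  true  _ = refl

straight-absent⇒different : ∀ a b → matching true false a b ≡ false → a ≢ b
straight-absent⇒different false true  _ ()
straight-absent⇒different true  false _ ()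

matching⇒bit : ∀ s c a b → matching s c a b ≡ true → 1 ≤ boolToℕ s + boolToℕ c
matching⇒bit true  c     a b _ = s≤s z≤n
matching⇒bit false true  a b _ = s≤s z≤n

≤1⇒not-full : ∀ s c → boolToℕ s + boolToℕ c ≤ 1 → s ∧ c ≡ false
≤1⇒not-full false c     _ = refl
≤1⇒not-full true  false _ = refl
≤1⇒not-full true  true  (s≤s ())

<1⇒no-edge : ∀ s c → boolToℕ s + boolToℕ c < 1 → ∀ a b → matching s c a b ≡ false
<1⇒no-edge false false _ a b = refl
<1⇒no-edge false true  (s≤s ()) a b
<1⇒no-edge true  c     (s≤s ()) a b

count : ∀ {N} → (Fin N → Bool) → ℕ
count {zero}  g = 0
count {suc N} g = boolToℕ (g zero) + count (λ x → g (suc x))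

count-tabulate : ∀ {N} {A : Set} (h : Fin N → A) (g : A → Bool) →
  countTrue (mapL g (tabulate h)) ≡ count (λ x → g (h x))
count-tabulate {zero}  h g = refl
count-tabulate {suc N} h g = cong (boolToℕ (g (h zero)) +_) (count-tabulate (λ x → h (suc x)) g)

count-allFin : ∀ {N} (g : Fin N → Bool) → countTrue (mapL g (allFin N)) ≡ count g
count-allFin g = count-tabulate (λ x → x) g

bit-split : ∀ a q → boolToℕ a ≡ boolToℕ (a ∧ q) + boolToℕ (a ∧ not q)
bit-split false q     = refl
bit-split true  false = refl
bit-split true  true  = refl

count-split : ∀ {N} (g p : Fin N → Bool) →
  count g ≡ count (λ x → g x ∧ p x) + count (λ x → g x ∧ not (p x))
count-split {zero}  g p = refl
count-split {suc N} g p
  rewrite count-split (λ x → g (suc x)) (λ x → p (suc x)) | bit-split (g zero) (p zero) =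
    +-interchange (boolToℕ (g zero ∧ p zero)) (boolToℕ (g zero ∧ not (p zero))) _ _

count-positive : ∀ {N} (g : Fin N → Bool) x → g x ≡ true → 1 ≤ count g
count-positive g zero    gx rewrite gx = s≤s z≤n
count-positive g (suc x) gx =
  ≤-trans (count-positive (λ y → g (suc y)) x gx) (m≤n+m _ (boolToℕ (g zero)))

count-const-true : ∀ N → count {N} (λ _ → true) ≡ N
count-const-true zero    = refl
count-const-true (suc N) = cong suc (count-const-true N)

-- Induction on the domain: the image of the first
-- true point is split off from g' with 'count-split'.
count-injection : ∀ {N N'} (g : Fin N → Bool) (g' : Fin N' → Bool) (e : Fin N → Fin N') →
  (∀ x → g x ≡ true → g' (e x) ≡ true) →
  (∀ x y → g x ≡ true → g y ≡ true → e x ≡ e y → x ≡ y) → count g ≤ count g'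
count-injection {zero} g g' e maps inj = z≤n
count-injection {suc N} {N'} g g' e maps inj with g zero in g0
... | false = count-injection (λ x → g (suc x)) g' (λ x → e (suc x)) (λ x → maps (suc x))
                (λ x y gx gy exy → fsuc-injective (inj (suc x) (suc y) gx gy exy))
... | true = subst (suc (count (λ x → g (suc x))) ≤_) (sym (count-split g' hit))
               (+-mono-≤ first rest)
  where
  hit : Fin N' → Bool
  hit x = does (x ≟ᶠ e zero)
  first : 1 ≤ count (λ x → g' x ∧ hit x)
  first = count-positive _ (e zero) (∧-true (maps zero g0) (dec-true (e zero ≟ᶠ e zero) refl))
  misses : ∀ x → g (suc x) ≡ true → not (hit (e (suc x))) ≡ true
  misses x gx =
    cong not (dec-false (e (suc x) ≟ᶠ e zero) (λ q → fzero≢fsuc (sym (inj (suc x) zero gx g0 q))))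
  rest : count (λ x → g (suc x)) ≤ count (λ x → g' x ∧ not (hit x))
  rest = count-injection (λ x → g (suc x)) (λ x → g' x ∧ not (hit x)) (λ x → e (suc x))
           (λ x gx → ∧-true (maps (suc x) gx) (misses x gx))
           (λ x y gx gy exy → fsuc-injective (inj (suc x) (suc y) gx gy exy))

count≤ : ∀ {N} k (g : Fin N → Bool) (ι : Fin N → Fin k) →
  (∀ x y → g x ≡ true → g y ≡ true → ι x ≡ ι y → x ≡ y) → count g ≤ k
count≤ k g ι inj =
  subst (count g ≤_) (count-const-true k) (count-injection g (λ _ → true) ι (λ _ _ → refl) inj)

count≥ : ∀ {N} k (g : Fin N → Bool) (ι : Fin k → Fin N) → (∀ x → g (ι x) ≡ true) →
  (∀ x y → ι x ≡ ι y → x ≡ y) → k ≤ count g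
count≥ k g ι hits inj =
  subst (_≤ count g) (count-const-true k)
    (count-injection (λ _ → true) g ι (λ x _ → hits x) (λ x y _ _ → inj x y))

straightBit crossedBit : ∀ {G} → Cover G → Fin (n G) → Fin (n G) → Bool
straightBit C u v = E C u false v false
crossedBit  C u v = E C u false v true

matchingCount : ∀ {G} → Cover G → Fin (n G) → Fin (n G) → ℕ
matchingCount C u v = boolToℕ (straightBit C u v) + boolToℕ (crossedBit C u v)

E-matching : ∀ {G} (C : Cover G) u v → u ≢ v →
  ∀ a b → E C u a v b ≡ matching (straightBit C u v) (crossedBit C u v) a b
E-matching C u v u≢v a b with E-between C u v u≢v
... | s , c , _ , E≡ rewrite E≡ false false | E≡ false true
                           | matching-straight-bit s c | matching-crossed-bit s c = E≡ a b

matchingCount≤mult : ∀ {G} (C : Cover G) u v → u ≢ v → matchingCount C u v ≤ mult G u v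
matchingCount≤mult C u v u≢v with E-between C u v u≢v
... | s , c , s+c≤ , E≡ rewrite E≡ false false | E≡ false true
                             | matching-straight-bit s c | matching-crossed-bit s c = s+c≤

E⇒adjacent : ∀ {G} (C : Cover G) u v a b → u ≢ v → E C u a v b ≡ true → 0 < mult G u v
E⇒adjacent C u v a b u≢v uv =
  ≤-trans (matching⇒bit (straightBit C u v) (crossedBit C u v) a b
            (trans (sym (E-matching C u v u≢v a b)) uv))
          (matchingCount≤mult C u v u≢v)

full : ∀ {G} → Cover G → Fin (n G) → Fin (n G) → Bool
full C u v = straightBit C u v ∧ crossedBit C u v

not-full-by-count : ∀ {G} (C : Cover G) u v → matchingCount C u v ≤ 1 → full C u v ≡ false
not-full-by-count C u v = ≤1⇒not-full (straightBit C u v) (crossedBit C u v)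

empty-by-count : ∀ {G} (C : Cover G) u v → u ≢ v → matchingCount C u v < 1 →
  ∀ a b → E C u a v b ≡ false
empty-by-count C u v u≢v none a b =
  trans (E-matching C u v u≢v a b) (<1⇒no-edge (straightBit C u v) (crossedBit C u v) none a b)

module _ {G : MultiGraph} (C : Cover G) {u v : Fin (n G)} (u≢v : u ≢ v) where

  private
    s = straightBit C u v
    c = crossedBit C u v

  E-flip-both : ∀ a b → E C u (not a) v (not b) ≡ E C u a v b
  E-flip-both a b = begin
    E C u (not a) v (not b)      ≡⟨ E-matching C u v u≢v (not a) (not b) ⟩
    matching s c (not a) (not b) ≡⟨ matching-flip-both s c a b ⟩
    matching s c a b             ≡⟨ sym (E-matching C u v u≢v a b) ⟩
    E C u a v b                  ∎
    where open ≡-Reasoning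

  E-flip-swap : ∀ a b → E C u (not a) v b ≡ E C u a v (not b)
  E-flip-swap a b = begin
    E C u (not a) v b      ≡⟨ E-matching C u v u≢v (not a) b ⟩
    matching s c (not a) b ≡⟨ matching-flip-swap s c a b ⟩
    matching s c a (not b) ≡⟨ sym (E-matching C u v u≢v a (not b)) ⟩
    E C u a v (not b)      ∎
    where open ≡-Reasoning

  E-avoid : ∀ a → full C u v ≡ false → E C u a v (E C u a v false) ≡ false
  E-avoid a not-full = begin
    E C u a v (E C u a v false)               ≡⟨ E-matching C u v u≢v a _ ⟩
    matching s c a (E C u a v false)          ≡⟨ cong (matching s c a) (E-matching C u v u≢v a false) ⟩
    matching s c a (matching s c a false)     ≡⟨ matching-avoid s c a not-full ⟩
    false                                     ∎
    where open ≡-Reasoning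

  E-avoid-fails : ∀ a → E C u a v (E C u a v false) ≡ true → full C u v ≡ true
  E-avoid-fails a conflict with full C u v in eq
  ... | true  = refl
  ... | false = ⊥-elim (true≢false (trans (sym conflict) (E-avoid a eq)))

  E-flip-one : ∀ a b → full C u v ≡ false → E C u a v b ≡ true → E C u a v (not b) ≡ false
  E-flip-one a b not-full ab = begin
    E C u a v (not b)      ≡⟨ E-matching C u v u≢v a (not b) ⟩
    matching s c a (not b) ≡⟨ matching-flip-one s c a b not-full (trans (sym (E-matching C u v u≢v a b)) ab) ⟩
    false                  ∎
    where open ≡-Reasoning

module _ {G : MultiGraph} (C : Cover G) {u v : Fin (n G)} (u≢v : u ≢ v) where

  straightBit-sym : straightBit C v u ≡ straightBit C u v
  straightBit-sym = E-sym C v false u false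

  crossedBit-sym : crossedBit C v u ≡ crossedBit C u v
  crossedBit-sym = trans (E-sym C v false u true) (E-flip-swap C u≢v false false)

  matchingCount-sym : matchingCount C v u ≡ matchingCount C u v
  matchingCount-sym = cong₂ (λ s c → boolToℕ s + boolToℕ c) straightBit-sym crossedBit-sym

  full-sym : full C v u ≡ full C u v
  full-sym = cong₂ _∧_ straightBit-sym crossedBit-sym

-- A pair of distinct vertices over which the cover uses fewer matchings than
-- there are parallel edges.  Covers of proper subgraphs become such covers of G.
Deficient : (G : MultiGraph) → Cover G → Set
Deficient G C = Σ (Fin (n G)) λ x → Σ (Fin (n G)) λ y →
  x ≢ y × matchingCount C x y < mult G x y

conflict : ∀ {G} → Cover G → (Fin (n G) → Bool) → Fin (n G) → Fin (n G) → Bool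
conflict C φ v w = not (does (w ≟ᶠ v)) ∧ E C v (φ v) w (φ w)

Conflict : ∀ {G} → Cover G → (Fin (n G) → Bool) → Fin (n G) → Fin (n G) → Set
Conflict C φ v w = w ≢ v × E C v (φ v) w (φ w) ≡ true

conflict⇒Conflict : ∀ {G} (C : Cover G) φ v w → conflict C φ v w ≡ true → Conflict C φ v w
conflict⇒Conflict C φ v w c =
  does-false (w ≟ᶠ v) (not-true (∧-true-left c)) , ∧-true-right c
  where
  not-true : ∀ {b} → not b ≡ true → b ≡ false
  not-true {false} _ = refl

Conflict⇒conflict : ∀ {G} (C : Cover G) φ v w → Conflict C φ v w → conflict C φ v w ≡ true
Conflict⇒conflict C φ v w (w≢v , vw) = ∧-true (cong not (dec-false (w ≟ᶠ v) w≢v)) vw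

degφ≡count : ∀ {G} (C : Cover G) φ v → degφ C φ v ≡ count (conflict C φ v)
degφ≡count C φ v = count-allFin (conflict C φ v)

degree≤ : ∀ {G} (C : Cover G) φ v {k} (ι : Fin (n G) → Fin k) →
  (∀ w w' → Conflict C φ v w → Conflict C φ v w' → ι w ≡ ι w' → w ≡ w') →
  degφ C φ v ≤ k
degree≤ C φ v {k} ι inj = subst (_≤ k) (sym (degφ≡count C φ v))
  (count≤ k (conflict C φ v) ι (λ w w' cw cw' →
    inj w w' (conflict⇒Conflict C φ v w cw) (conflict⇒Conflict C φ v w' cw')))

degree≥ : ∀ {G} (C : Cover G) φ v {k} (ι : Fin k → Fin (n G)) →
  (∀ j → Conflict C φ v (ι j)) → (∀ j j' → ι j ≡ ι j' → j ≡ j') →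
  k ≤ degφ C φ v
degree≥ C φ v {k} ι conflicts inj = subst (k ≤_) (sym (degφ≡count C φ v))
  (count≥ k (conflict C φ v) ι (λ j → Conflict⇒conflict C φ v (ι j) (conflicts j)) inj)

-- A cover of a subgraph
-- S of G extends to a cover of G: copy it over the image of S and add no
-- other edges between distinct lists.  When S is proper the extension is
-- deficient, and every colouring of it restricts to a colouring of the
-- original cover, since restriction does not create conflicts.

HasNeighbour : MultiGraph → Set
HasNeighbour G = ∀ x → Σ (Fin (n G)) λ y → x ≢ y × 0 < mult G x y

module Extension {G : MultiGraph} (S : Subgraph G) (C : Cover (H S)) where

  private
    e = emb S

  preimage? : (x : Fin (n G)) → Dec (∃ λ a → e a ≡ x)
  preimage? x = any? (λ a → e a ≟ᶠ x)

  edgeBy : (x y : Fin (n G)) → Dec (x ≡ y) → Dec (∃ λ a → e a ≡ x) → Dec (∃ λ b → e b ≡ y) →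
    Bool → Bool → Bool
  edgeBy x y (yes _) _             _             α β = not (α == β)
  edgeBy x y (no _)  (yes (a , _)) (yes (b , _)) α β = E C a α b β
  edgeBy x y (no _)  _             _             α β = false

  extE : Fin (n G) → Bool → Fin (n G) → Bool → Bool
  extE x α y β = edgeBy x y (x ≟ᶠ y) (preimage? x) (preimage? y) α β

  extE-sym : ∀ x α y β → extE x α y β ≡ extE y β x α
  extE-sym x α y β with x ≟ᶠ y | y ≟ᶠ x
  ... | yes _  | yes _  = cong not (==-sym α β)
  ... | yes xy | no ¬yx = ⊥-elim (¬yx (sym xy))
  ... | no ¬xy | yes yx = ⊥-elim (¬xy (sym yx))
  ... | no _   | no _ with preimage? x | preimage? y
  ...   | yes (a , _) | yes (b , _) = E-sym C a α b β
  ...   | yes _       | no _        = refl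
  ...   | no _        | yes _       = refl
  ...   | no _        | no _        = refl

  extE-inside : ∀ x α β → extE x α x β ≡ not (α == β)
  extE-inside x α β with x ≟ᶠ x
  ... | yes _ = refl
  ... | no ¬xx = ⊥-elim (¬xx refl)

  extE-between : ∀ u v → u ≢ v →
    Σ Bool λ s → Σ Bool λ c →
      (boolToℕ s + boolToℕ c ≤ mult G u v) ×
      (∀ a b → extE u a v b ≡ matching s c a b)
  extE-between u v u≢v with u ≟ᶠ v
  ... | yes u≡v = ⊥-elim (u≢v u≡v)
  ... | no _ with preimage? u | preimage? v
  ...   | yes (a , refl) | yes (b , refl) with E-between C a b (λ a≡b → u≢v (cong e a≡b))
  ...     | s , c , s+c≤ , E≡ = s , c , ≤-trans s+c≤ (mult-≤ S a b) , E≡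
  extE-between u v u≢v | no _ | yes _ | no _ = false , false , z≤n , λ _ _ → refl
  extE-between u v u≢v | no _ | no _  | _    = false , false , z≤n , λ _ _ → refl

  extended : Cover G
  extended = record
    { E = extE ; E-sym = extE-sym ; E-inside = extE-inside ; E-between = extE-between }

  extE-emb : ∀ a α b β → extE (e a) α (e b) β ≡ E C a α b β
  extE-emb a α b β with e a ≟ᶠ e b
  ... | yes ea≡eb with emb-inj S a b ea≡eb
  ...   | refl = sym (E-inside C a α β)
  extE-emb a α b β | no _ with preimage? (e a) | preimage? (e b)
  ... | yes (a' , a'↦) | yes (b' , b'↦) with emb-inj S a' a a'↦ | emb-inj S b' b b'↦
  ...   | refl | refl = refl
  extE-emb a α b β | no _ | no ¬pre | _        = ⊥-elim (¬pre (a , refl))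
  extE-emb a α b β | no _ | yes _   | no ¬pre = ⊥-elim (¬pre (b , refl))

  extE-outside : ∀ x α y β → x ≢ y → ¬ (∃ λ a → e a ≡ x) → extE x α y β ≡ false
  extE-outside x α y β x≢y ¬pre with x ≟ᶠ y
  ... | yes x≡y = ⊥-elim (x≢y x≡y)
  ... | no _ with preimage? x
  ...   | yes pre = ⊥-elim (¬pre pre)
  ...   | no _    = refl

  extended-deficient : IsProper S → HasNeighbour G → Deficient G extended
  extended-deficient proper nbr with all? preimage?
  ... | no ¬onto with ¬∀⟶∃¬ _ _ preimage? ¬onto
  ...   | x , ¬pre with nbr x
  ...     | y , x≢y , adjacent =
    x , y , x≢y ,
    subst (λ z → z < mult G x y)
      (sym (cong₂ (λ s c → boolToℕ s + boolToℕ c)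
        (extE-outside x false y false x≢y ¬pre) (extE-outside x false y true x≢y ¬pre)))
      adjacent
  extended-deficient proper nbr | yes onto
    with all? (λ a → all? (λ b → mult (H S) a b ≟ mult G (e a) (e b)))
  ... | yes same = ⊥-elim (proper (onto , same))
  ... | no ¬same with ¬∀⟶∃¬ _ _ (λ a → all? (λ b → mult (H S) a b ≟ mult G (e a) (e b))) ¬same
  ...   | a , ¬sameₐ with ¬∀⟶∃¬ _ _ (λ b → mult (H S) a b ≟ mult G (e a) (e b)) ¬sameₐ
  ...     | b , dropped = e a , e b , ea≢eb , fewer
    where
    a≢b : a ≢ b
    a≢b refl = dropped (trans (loopless (H S) a) (sym (loopless G (e a))))
    ea≢eb : e a ≢ e b
    ea≢eb ea≡eb = a≢b (emb-inj S a b ea≡eb)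
    fewer : matchingCount extended (e a) (e b) < mult G (e a) (e b)
    fewer rewrite extE-emb a false b false | extE-emb a false b true =
      ≤-<-trans (matchingCount≤mult C a b a≢b) (≤∧≢⇒< (mult-≤ S a b) dropped)

  restrict : ∀ {i} → HasIIColoring i extended → HasIIColoring i C
  restrict {i} (φ , φ-ok) = (λ a → φ (e a)) , ok
    where
    ok : IsIIColoring i C (λ a → φ (e a))
    ok a = begin
      degφ C (λ b → φ (e b)) a                   ≡⟨ degφ≡count C _ a ⟩
      count (conflict C (λ b → φ (e b)) a)       ≤⟨ count-injection _ _ e keeps (λ b b' _ _ → emb-inj S b b') ⟩
      count (conflict extended φ (e a))          ≡⟨ sym (degφ≡count extended φ (e a)) ⟩
      degφ extended φ (e a)                      ≤⟨ φ-ok (e a) ⟩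
      i                                          ∎
      where
      open ≤-Reasoning
      keeps : ∀ b → conflict C (λ b → φ (e b)) a b ≡ true → conflict extended φ (e a) (e b) ≡ true
      keeps b cb with conflict⇒Conflict C _ a b cb
      ... | b≢a , ab = Conflict⇒conflict extended φ (e a) (e b)
              ((λ eb≡ea → b≢a (emb-inj S b a eb≡ea)) , trans (extE-emb a (φ (e a)) b (φ (e b))) ab)

proper-subgraphs-colourable : ∀ i (G : MultiGraph) →
  (∀ (C : Cover G) → Deficient G C → HasIIColoring i C) → HasNeighbour G →
  ∀ (S : Subgraph G) → IsProper S → ∀ (C : Cover (H S)) → HasIIColoring i C
proper-subgraphs-colourable i G deficient-colourable nbr S proper C =
  restrict (deficient-colourable extended (extended-deficient proper nbr))
  where open Extension S C

-- Vertex 0 ≤ a < M = 2m is the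
-- cycle vertex v_a; vertex b ≥ M is a flag attached at the even cycle vertex
-- attach b.

module Structure (k m' : ℕ) where

  i m M N : ℕ
  i = suc k
  m = suc m'
  M = 2 * m
  N = M + m * i

  G : MultiGraph
  G = Gm i m

  -- the last cycle vertex v_{2m-1}; suc top ≡ M holds by computation
  top : ℕ
  top = pred M

  attach : ℕ → ℕ
  attach b = 2 * ((b ∸ M) / i)

  CycleEdge : ℕ → ℕ → Set
  CycleEdge a b = a < M × b < M × (b ≡ suc a ⊎ (suc a ≡ M × b ≡ 0))

  FlagEdge : ℕ → ℕ → Set
  FlagEdge a b = a < M × M ≤ b × a ≡ attach b

  Adjacency : ℕ → ℕ → Set
  Adjacency a b = CycleEdge a b ⊎ CycleEdge b a ⊎ FlagEdge a b ⊎ FlagEdge b a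

  CycleAdjacent : ℕ → ℕ → Set
  CycleAdjacent a b = CycleEdge a b ⊎ CycleEdge b a

  Between : ℕ → ℕ → ℕ → ℕ → Set
  Between p t a b = (a ≡ p × b ≡ t) ⊎ (a ≡ t × b ≡ p)

  M≥2 : 2 ≤ M
  M≥2 = *-monoʳ-≤ 2 {1} {m} (s≤s z≤n)

  M≥4 : 2 ≤ m → 4 ≤ M
  M≥4 m≥2 = *-monoʳ-≤ 2 m≥2

  M≤N : M ≤ N
  M≤N = m≤m+n M (m * i)

  <M⇒<N : ∀ {a} → a < M → a < N
  <M⇒<N a<M = ≤-trans a<M M≤N

  wrapEdge : CycleEdge top 0
  wrapEdge = ≤-refl , ≤-trans (s≤s z≤n) M≥2 , inj₂ (refl , refl)

  CycleEdge<N : ∀ {a b} → CycleEdge a b → a < N × b < N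
  CycleEdge<N (a<M , b<M , _) = <M⇒<N a<M , <M⇒<N b<M

  CycleEdge-≢ : ∀ {a b} → CycleEdge a b → a ≢ b
  CycleEdge-≢ (_ , _ , inj₁ refl)       a≡b  = <-irrefl a≡b (n<1+n _)
  CycleEdge-≢ (_ , _ , inj₂ (M≡1 , refl)) refl = <-irrefl M≡1 M≥2

  baseGFromTests : Bool → Bool → Bool → Bool → Bool → Bool → ℕ
  baseGFromTests a<M b<M forward wraps b≡0 attached =
    (if a<M ∧ b<M ∧ (forward ∨ (wraps ∧ b≡0)) then 1 else 0)
    + (if a<M ∧ not b<M ∧ attached then 2 else 0)

  baseG-tests : ∀ a b {t₁ t₂ t₃ t₄ t₅ t₆} →
    does (a <? M) ≡ t₁ → does (b <? M) ≡ t₂ → does (b ≟ suc a) ≡ t₃ →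
    does (suc a ≟ M) ≡ t₄ → does (b ≟ 0) ≡ t₅ → does (a ≟ attach b) ≡ t₆ →
    baseG i m a b ≡ baseGFromTests t₁ t₂ t₃ t₄ t₅ t₆
  baseG-tests a b refl refl refl refl refl refl = refl

  baseG-positive : ∀ a b → 0 < baseG i m a b → CycleEdge a b ⊎ FlagEdge a b
  baseG-positive a b = from (a <? M) (b <? M) (b ≟ suc a) (suc a ≟ M)
                            (b ≟ 0) (a ≟ attach b)
    where
    from : (d₁ : Dec (a < M)) (d₂ : Dec (b < M)) (d₃ : Dec (b ≡ suc a)) (d₄ : Dec (suc a ≡ M))
           (d₅ : Dec (b ≡ 0)) (d₆ : Dec (a ≡ attach b)) →
      0 < baseGFromTests (does d₁) (does d₂) (does d₃) (does d₄) (does d₅) (does d₆) →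
      CycleEdge a b ⊎ FlagEdge a b
    from (yes a<M) (yes b<M) (yes fwd) _ _ _ _ = inj₁ (a<M , b<M , inj₁ fwd)
    from (yes a<M) (yes b<M) (no _) (yes wraps) (yes b≡0) _ _ = inj₁ (a<M , b<M , inj₂ (wraps , b≡0))
    from (yes a<M) (no b≮M) _ _ _ (yes att) _ = inj₂ (a<M , ≮⇒≥ b≮M , att)
    from (no _)    _         _ _ _ _ ()
    from (yes _)   (yes _)   (no _) (yes _) (no _) _ ()
    from (yes _)   (yes _)   (no _) (no _)  _      _ ()
    from (yes _)   (no _)    _      _       _      (no _) ()

  baseG-forward : ∀ a → suc a < M → baseG i m a (suc a) ≡ 1
  baseG-forward a sa<M = baseG-tests a (suc a) (dec-true (a <? M) (<⇒≤ sa<M))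
    (dec-true (suc a <? M) sa<M) (dec-true (suc a ≟ suc a) refl) refl refl refl

  baseG-wrap : ∀ a → suc a ≡ M → baseG i m a 0 ≡ 1
  baseG-wrap a sa≡M = baseG-tests a 0 (dec-true (a <? M) (subst (a <_) sa≡M (n<1+n a)))
    (dec-true (0 <? M) (s≤s z≤n)) (dec-false (0 ≟ suc a) (λ ()))
    (dec-true (suc a ≟ M) sa≡M) (dec-true (0 ≟ 0) refl) refl

  baseG-backward : 2 ≤ m → ∀ a → suc a < M → baseG i m (suc a) a ≡ 0
  baseG-backward m≥2 zero 1<M = baseG-tests 1 0 (dec-true (1 <? M) 1<M)
    (dec-true (0 <? M) (<⇒≤ 1<M)) (dec-false (0 ≟ 2) (λ ()))
    (dec-false (2 ≟ M) (λ 2≡M → <-irrefl 2≡M (≤-trans (s≤s (s≤s (s≤s z≤n))) (M≥4 m≥2))))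
    refl refl
  baseG-backward m≥2 (suc a) ssa<M = trans
    (baseG-tests (suc (suc a)) (suc a) (dec-true (suc (suc a) <? M) ssa<M)
      (dec-true (suc a <? M) (<⇒≤ ssa<M))
      (dec-false (suc a ≟ suc (suc (suc a))) (λ eq → <-irrefl eq (m≤n⇒m≤1+n (n<1+n (suc a)))))
      refl (dec-false (suc a ≟ 0) (λ ())) refl)
    (zero-count (does (suc (suc (suc a)) ≟ M)) (does (suc (suc a) ≟ attach (suc a))))
    where
    zero-count : ∀ t₄ t₆ → baseGFromTests true true false t₄ false t₆ ≡ 0
    zero-count false t₆ = refl
    zero-count true  t₆ = refl

  baseG-wrap-back : 2 ≤ m → ∀ a → suc a ≡ M → baseG i m 0 a ≡ 0
  baseG-wrap-back m≥2 a sa≡M = baseG-tests 0 a (dec-true (0 <? M) (s≤s z≤n))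
    (dec-true (a <? M) (subst (a <_) sa≡M (n<1+n a)))
    (dec-false (a ≟ 1) (λ a≡1 → <-irrefl (trans (cong suc (sym a≡1)) sa≡M)
                                                 (≤-trans (s≤s (s≤s (s≤s z≤n))) (M≥4 m≥2))))
    (dec-false (1 ≟ M) (λ 1≡M → <-irrefl 1≡M M≥2)) refl refl

  baseG-flag : ∀ {a b} → FlagEdge a b → baseG i m a b ≡ 2
  baseG-flag {a} {b} (a<M , M≤b , att) =
    baseG-tests a b (dec-true (a <? M) a<M) (dec-false (b <? M) (≤⇒≯ M≤b)) refl refl refl
      (dec-true (a ≟ attach b) att)

  baseG-from-flag : ∀ a b → M ≤ b → baseG i m b a ≡ 0
  baseG-from-flag a b M≤b = baseG-tests b a (dec-false (b <? M) (≤⇒≯ M≤b)) refl refl refl refl refl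

  mG : ℕ → ℕ → ℕ
  mG a b = baseG i m a b + baseG i m b a

  mG-sym : ∀ a b → mG b a ≡ mG a b
  mG-sym a b = +-comm (baseG i m b a) (baseG i m a b)

  cycle-mult-positive : ∀ {a b} → CycleEdge a b → 1 ≤ mG a b
  cycle-mult-positive {a} {b} (_ , b<M , inj₁ refl) =
    subst (λ z → 1 ≤ z + baseG i m b a) (sym (baseG-forward a b<M)) (s≤s z≤n)
  cycle-mult-positive {a} {b} (_ , _ , inj₂ (sa≡M , refl)) =
    subst (λ z → 1 ≤ z + baseG i m b a) (sym (baseG-wrap a sa≡M)) (s≤s z≤n)

  cycle-mult≡1 : 2 ≤ m → ∀ {a b} → CycleEdge a b → mG a b ≡ 1
  cycle-mult≡1 m≥2 (_ , b<M , inj₁ refl) =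
    cong₂ _+_ (baseG-forward _ b<M) (baseG-backward m≥2 _ b<M)
  cycle-mult≡1 m≥2 (_ , _ , inj₂ (sa≡M , refl)) =
    cong₂ _+_ (baseG-wrap _ sa≡M) (baseG-wrap-back m≥2 _ sa≡M)

  flag-mult≡2 : ∀ {a b} → FlagEdge a b → mG a b ≡ 2
  flag-mult≡2 {a} {b} fl@(_ , M≤b , _) = cong₂ _+_ (baseG-flag fl) (baseG-from-flag a b M≤b)

  vertex : ℕ → Fin N
  vertex a with a <? N
  ... | yes a<N = fromℕ< a<N
  ... | no _    = zero

  toℕ-vertex : ∀ {a} → a < N → toℕ (vertex a) ≡ a
  toℕ-vertex {a} a<N with a <? N
  ... | yes a<N' = toℕ-fromℕ< a<N'
  ... | no a≮N   = ⊥-elim (a≮N a<N)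

  vertex-toℕ : ∀ (x : Fin N) → vertex (toℕ x) ≡ x
  vertex-toℕ x = toℕ-injective (toℕ-vertex (toℕ<n x))

  vertex-≢ : ∀ {a b} → a < N → b < N → a ≢ b → vertex a ≢ vertex b
  vertex-≢ a<N b<N a≢b va≡vb =
    a≢b (trans (sym (toℕ-vertex a<N)) (trans (cong toℕ va≡vb) (toℕ-vertex b<N)))

  mult-toℕ : ∀ (x y : Fin N) → x ≢ y → mult G x y ≡ mG (toℕ x) (toℕ y)
  mult-toℕ x y x≢y with x ≟ᶠ y
  ... | yes x≡y = ⊥-elim (x≢y x≡y)
  ... | no _    = refl

  mult-vertex : ∀ {a b} → a < N → b < N → a ≢ b → mult G (vertex a) (vertex b) ≡ mG a b
  mult-vertex a<N b<N a≢b = trans (mult-toℕ _ _ (vertex-≢ a<N b<N a≢b))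
                                  (cong₂ mG (toℕ-vertex a<N) (toℕ-vertex b<N))

  adjacent : ∀ (x y : Fin N) → x ≢ y → 0 < mult G x y → Adjacency (toℕ x) (toℕ y)
  adjacent x y x≢y pos with baseG i m (toℕ x) (toℕ y) in xy
  ... | suc _ with baseG-positive (toℕ x) (toℕ y) (subst (0 <_) (sym xy) (s≤s z≤n))
  ...   | inj₁ cyc = inj₁ cyc
  ...   | inj₂ fl  = inj₂ (inj₂ (inj₁ fl))
  adjacent x y x≢y pos | zero
    with baseG-positive (toℕ y) (toℕ x)
           (subst (λ z → 0 < z + baseG i m (toℕ y) (toℕ x)) xy (subst (0 <_) (mult-toℕ x y x≢y) pos))
  ...   | inj₁ cyc = inj₂ (inj₁ cyc)
  ...   | inj₂ fl  = inj₂ (inj₂ (inj₂ fl))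

  attach<M : ∀ b → b < N → attach b < M
  attach<M b b<N = *-monoʳ-< 2 (m<n*o⇒m/o<n {b ∸ M} {m} {i} offset<)
    where
    offset< : b ∸ M < m * i
    offset< with M ≤? b
    ... | yes M≤b = subst (b ∸ M <_) (m+n∸m≡n M (m * i)) (∸-monoˡ-< b<N M≤b)
    ... | no M≰b  = subst (_< m * i) (sym (m≤n⇒m∸n≡0 (<⇒≤ (≰⇒> M≰b)))) (s≤s z≤n)

  neighbour-at : ∀ (x : Fin N) b → b < N → toℕ x ≢ b → 1 ≤ mG (toℕ x) b →
    Σ (Fin N) λ y → x ≢ y × 0 < mult G x y
  neighbour-at x b b<N x≢b pos =
    vertex b , x≢vb ,
    subst (1 ≤_) (sym (trans (mult-toℕ x (vertex b) x≢vb) (cong (mG (toℕ x)) (toℕ-vertex b<N)))) pos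
    where
    x≢vb : x ≢ vertex b
    x≢vb x≡vb = x≢b (trans (cong toℕ x≡vb) (toℕ-vertex b<N))

  has-neighbour : HasNeighbour G
  has-neighbour x with toℕ x <? M
  ... | yes x<M with suc (toℕ x) <? M
  ...   | yes sx<M = neighbour-at x (suc (toℕ x)) (<M⇒<N sx<M) (CycleEdge-≢ cyc) (cycle-mult-positive cyc)
    where cyc = x<M , sx<M , inj₁ refl
  ...   | no sx≮M = neighbour-at x 0 (<M⇒<N 0<M) (CycleEdge-≢ cyc) (cycle-mult-positive cyc)
    where
    0<M = ≤-trans (s≤s z≤n) M≥2
    cyc = x<M , 0<M , inj₂ (≤-antisym x<M (≮⇒≥ sx≮M) , refl)
  has-neighbour x | no x≮M =
    neighbour-at x (attach (toℕ x)) (<M⇒<N att<M) (λ x≡att → x≮M (subst (_< M) (sym x≡att) att<M))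
      (subst (1 ≤_) (mG-sym (toℕ x) (attach (toℕ x)))
        (subst (1 ≤_) (sym (flag-mult≡2 (att<M , ≮⇒≥ x≮M , refl))) (s≤s z≤n)))
    where
    att<M = attach<M (toℕ x) (toℕ<n x)

  -- The i flags at a cycle vertex are told apart by their slot (b ∸ M) % i,
  -- since b ∸ M = slot + i · h with attach b = 2h.
  slot : ℕ → Fin i
  slot b = fromℕ< (m%n<n (b ∸ M) i)

  slot-injective : ∀ {a b b'} → FlagEdge a b → FlagEdge a b' → slot b ≡ slot b' → b ≡ b'
  slot-injective {a} {b} {b'} (_ , M≤b , a≡) (_ , M≤b' , a≡') same =
    begin
      b                             ≡⟨ sym (m∸n+n≡m M≤b) ⟩
      (b ∸ M) + M                   ≡⟨ cong (_+ M) offset≡ ⟩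
      (b' ∸ M) + M                  ≡⟨ m∸n+n≡m M≤b' ⟩
      b'                            ∎
    where
    open ≡-Reasoning
    quotient≡ : (b ∸ M) / i ≡ (b' ∸ M) / i
    quotient≡ = *-cancelˡ-≡ _ _ 2 (trans (sym a≡) a≡')
    remainder≡ : (b ∸ M) % i ≡ (b' ∸ M) % i
    remainder≡ = trans (sym (toℕ-fromℕ< (m%n<n (b ∸ M) i)))
                       (trans (cong toℕ same) (toℕ-fromℕ< (m%n<n (b' ∸ M) i)))
    offset≡ : b ∸ M ≡ b' ∸ M
    offset≡ = begin
      b ∸ M                            ≡⟨ m≡m%n+[m/n]*n (b ∸ M) i ⟩
      (b ∸ M) % i + (b ∸ M) / i * i    ≡⟨ cong₂ (λ r q → r + q * i) remainder≡ quotient≡ ⟩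
      (b' ∸ M) % i + (b' ∸ M) / i * i  ≡⟨ sym (m≡m%n+[m/n]*n (b' ∸ M) i) ⟩
      b' ∸ M                           ∎

-- Colour the path
-- v_0 … v_{M-1} greedily, each vertex avoiding its predecessor; then flip all
-- colours from position T on, which only affects the edge v_{T-1} v_T and the
-- wrap edge v_{M-1} v_0; finally colour every flag so that it avoids its
-- attachment vertex, which succeeds unless both matchings are present.

module Colouring (k m' : ℕ) (C : Cover (Gm (suc k) (suc m'))) where

  open Structure k m'

  Eℕ : ℕ → Bool → ℕ → Bool → Bool
  Eℕ a α b β = E C (vertex a) α (vertex b) β

  NotFull : ℕ → ℕ → Set
  NotFull a b = full C (vertex a) (vertex b) ≡ false

  cycle-≢ : ∀ {a b} → CycleEdge a b → vertex a ≢ vertex b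
  cycle-≢ cyc = vertex-≢ (proj₁ (CycleEdge<N cyc)) (proj₂ (CycleEdge<N cyc)) (CycleEdge-≢ cyc)

  greedy : ℕ → Bool
  greedy zero    = false
  greedy (suc j) = Eℕ j (greedy j) (suc j) false

  cycleColour : ℕ → ℕ → Bool
  cycleColour start a = if start ≤ᵇ a then not (greedy a) else greedy a

  wrapConflict : Bool
  wrapConflict = Eℕ top (greedy top) 0 false

  colourBy : ℕ → (a : ℕ) → Dec (a < M) → Bool
  colourBy start a (yes _) = cycleColour start a
  colourBy start a (no _)  = Eℕ (attach a) (cycleColour start (attach a)) a false

  colour : ℕ → Fin N → Bool
  colour start x = colourBy start (toℕ x) (toℕ x <? M)

  colour-cycle : ∀ start x → toℕ x < M → colour start x ≡ cycleColour start (toℕ x)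
  colour-cycle start x x<M with toℕ x <? M
  ... | yes _   = refl
  ... | no x≮M  = ⊥-elim (x≮M x<M)

  colour-flag : ∀ start x → M ≤ toℕ x →
    colour start x ≡ Eℕ (attach (toℕ x)) (cycleColour start (attach (toℕ x))) (toℕ x) false
  colour-flag start x M≤x with toℕ x <? M
  ... | yes x<M = ⊥-elim (≤⇒≯ M≤x x<M)
  ... | no _    = refl

  CycleConflict : ℕ → ℕ → ℕ → Set
  CycleConflict start a b = Eℕ a (cycleColour start a) b (cycleColour start b) ≡ true

  greedy-avoids : ∀ a → (cyc : CycleEdge a (suc a)) → NotFull a (suc a) →
    Eℕ a (greedy a) (suc a) (greedy (suc a)) ≡ false
  greedy-avoids a cyc = E-avoid C (cycle-≢ cyc) (greedy a)

  forward-conflict : ∀ start a → (cyc : CycleEdge a (suc a)) → NotFull a (suc a) →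
    CycleConflict start a (suc a) → suc a ≡ start
  forward-conflict start a cyc not-full conflict
    with start ≤ᵇ a in start≤a | start ≤ᵇ suc a in start≤sa
  ... | true  | true  = ⊥-elim (true≢false (trans (sym conflict)
          (trans (E-flip-both C (cycle-≢ cyc) (greedy a) (greedy (suc a))) (greedy-avoids a cyc not-full))))
  ... | false | false = ⊥-elim (true≢false (trans (sym conflict) (greedy-avoids a cyc not-full)))
  ... | false | true  = ≤-antisym (≤ᵇ-false start≤a) (≤ᵇ-true start≤sa)
  ... | true  | false =
    ⊥-elim (<⇒≱ (≤ᵇ-false {start} {suc a} start≤sa) (m≤n⇒m≤1+n (≤ᵇ-true {start} {a} start≤a)))

  -- When the flipping starts at suc j ≥ 1, v_0 keeps its greedy colour.  If
  -- v_{M-1} is not flipped, a conflict on the wrap edge is the greedy one; if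
  -- it is flipped, the greedy colouring had no conflict there.
  wrap-conflict : ∀ j → NotFull top 0 → CycleConflict (suc j) top 0 →
    (top < suc j × wrapConflict ≡ true) ⊎ (suc j ≤ top × wrapConflict ≡ false)
  wrap-conflict j not-full conflict with suc j ≤ᵇ top in j<top
  ... | false = inj₁ (≤ᵇ-false j<top , conflict)
  ... | true  = inj₂ (≤ᵇ-true j<top , ¬-not greedy-conflict⇒no-conflict)
    where
    greedy-conflict⇒no-conflict : wrapConflict ≢ true
    greedy-conflict⇒no-conflict greedy-conflicts = true≢false (trans (sym conflict)
      (trans (E-flip-swap C (cycle-≢ wrapEdge) (greedy top) false)
             (E-flip-one C (cycle-≢ wrapEdge) (greedy top) false not-full greedy-conflicts)))

  flag-colour : ∀ start v w → toℕ v < M → FlagEdge (toℕ v) (toℕ w) →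
    colour start w ≡ E C v (colour start v) w false
  flag-colour start v w v<M (_ , M≤w , v≡att) = begin
    colour start w
      ≡⟨ colour-flag start w M≤w ⟩
    Eℕ (attach (toℕ w)) (cycleColour start (attach (toℕ w))) (toℕ w) false
      ≡⟨ cong (λ a → Eℕ a (cycleColour start a) (toℕ w) false) (sym v≡att) ⟩
    E C (vertex (toℕ v)) (cycleColour start (toℕ v)) (vertex (toℕ w)) false
      ≡⟨ cong₂ (λ x y → E C x (cycleColour start (toℕ v)) y false) (vertex-toℕ v) (vertex-toℕ w) ⟩
    E C v (cycleColour start (toℕ v)) w false
      ≡⟨ cong (λ α → E C v α w false) (sym (colour-cycle start v v<M)) ⟩
    E C v (colour start v) w false
      ∎
    where open ≡-Reasoning

  flag-conflict⇒full : ∀ start v w → toℕ v < M → FlagEdge (toℕ v) (toℕ w) →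
    Conflict C (colour start) v w → full C v w ≡ true
  flag-conflict⇒full start v w v<M fl (w≢v , vw) =
    E-avoid-fails C (λ v≡w → w≢v (sym v≡w)) (colour start v)
      (subst (λ β → E C v (colour start v) w β ≡ true) (flag-colour start v w v<M fl) vw)

  conflict-at-cycle-vertex : ∀ start v w → toℕ v < M → Conflict C (colour start) v w →
    (FlagEdge (toℕ v) (toℕ w) × full C v w ≡ true) ⊎ CycleAdjacent (toℕ v) (toℕ w)
  conflict-at-cycle-vertex start v w v<M cf@(w≢v , vw)
    with adjacent v w v≢w (E⇒adjacent C v w _ _ v≢w vw)
    where
    v≢w : v ≢ w
    v≢w v≡w = w≢v (sym v≡w)
  ... | inj₁ cyc               = inj₂ (inj₁ cyc)
  ... | inj₂ (inj₁ cyc)        = inj₂ (inj₂ cyc)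
  ... | inj₂ (inj₂ (inj₁ fl))  = inj₁ (fl , flag-conflict⇒full start v w v<M fl cf)
  ... | inj₂ (inj₂ (inj₂ (_ , M≤v , _))) = ⊥-elim (≤⇒≯ M≤v v<M)

  conflict-at-flag : ∀ start v w → M ≤ toℕ v → Conflict C (colour start) v w → toℕ w ≡ attach (toℕ v)
  conflict-at-flag start v w M≤v (w≢v , vw)
    with adjacent v w v≢w (E⇒adjacent C v w _ _ v≢w vw)
    where
    v≢w : v ≢ w
    v≢w v≡w = w≢v (sym v≡w)
  ... | inj₁ (v<M , _)                  = ⊥-elim (≤⇒≯ M≤v v<M)
  ... | inj₂ (inj₁ (_ , v<M , _))       = ⊥-elim (≤⇒≯ M≤v v<M)
  ... | inj₂ (inj₂ (inj₁ (v<M , _)))    = ⊥-elim (≤⇒≯ M≤v v<M)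
  ... | inj₂ (inj₂ (inj₂ (_ , _ , w≡))) = w≡

  single-conflict-degree : ∀ start v (target : ℕ) →
    (∀ w → Conflict C (colour start) v w → toℕ w ≡ target) → degφ C (colour start) v ≤ i
  single-conflict-degree start v target only =
    ≤-trans (degree≤ C (colour start) v {1} (λ _ → zero)
              (λ w w' cw cw' _ → toℕ-injective (trans (only w cw) (sym (only w' cw')))))
            (s≤s z≤n)

  flag-degree : ∀ start v → M ≤ toℕ v → degφ C (colour start) v ≤ i
  flag-degree start v M≤v =
    single-conflict-degree start v (attach (toℕ v)) (λ w → conflict-at-flag start v w M≤v)

  cycle-degree-no-conflict : ∀ start v → toℕ v < M →
    (∀ w → CycleAdjacent (toℕ v) (toℕ w) → ¬ Conflict C (colour start) v w) →
    degφ C (colour start) v ≤ i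
  cycle-degree-no-conflict start v v<M none =
    degree≤ C (colour start) v (λ w → slot (toℕ w)) distinct
    where
    distinct : ∀ w w' → Conflict C (colour start) v w → Conflict C (colour start) v w' →
      slot (toℕ w) ≡ slot (toℕ w') → w ≡ w'
    distinct w w' cw cw' same
      with conflict-at-cycle-vertex start v w v<M cw | conflict-at-cycle-vertex start v w' v<M cw'
    ... | inj₁ (fl , _) | inj₁ (fl' , _) = toℕ-injective (slot-injective fl fl' same)
    ... | inj₂ adj      | _              = ⊥-elim (none w adj cw)
    ... | inj₁ _        | inj₂ adj'      = ⊥-elim (none w' adj' cw')

  slotBy : ℕ → (b : ℕ) → Dec (b < M) → Fin i
  slotBy reserved b (yes _) = slot reserved
  slotBy reserved b (no _)  = slot b

  slotOr : ℕ → ℕ → Fin i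
  slotOr reserved b = slotBy reserved b (b <? M)

  slotOr-cycle : ∀ reserved b → b < M → slotOr reserved b ≡ slot reserved
  slotOr-cycle reserved b b<M with b <? M
  ... | yes _   = refl
  ... | no b≮M  = ⊥-elim (b≮M b<M)

  slotOr-flag : ∀ reserved b → M ≤ b → slotOr reserved b ≡ slot b
  slotOr-flag reserved b M≤b with b <? M
  ... | yes b<M = ⊥-elim (≤⇒≯ M≤b b<M)
  ... | no _    = refl

  -- A cycle vertex v with a flag f that is not full may have conflicts with
  -- one cycle neighbour p: p takes the slot of f, which is not a conflict.
  cycle-degree-one-conflict : ∀ start v f (p : ℕ) → toℕ v < M → FlagEdge (toℕ v) f → f < N →
    NotFull (toℕ v) f →
    (∀ w → CycleAdjacent (toℕ v) (toℕ w) → Conflict C (colour start) v w → toℕ w ≡ p) →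
    degφ C (colour start) v ≤ i
  cycle-degree-one-conflict start v f p v<M flf f<N not-full only-p =
    degree≤ C (colour start) v (λ w → slotOr f (toℕ w)) distinct
    where
    flag-slot : ∀ w → FlagEdge (toℕ v) (toℕ w) → slotOr f (toℕ w) ≡ slot (toℕ w)
    flag-slot w (_ , M≤w , _) = slotOr-flag f (toℕ w) M≤w
    cycle-slot : ∀ w → CycleAdjacent (toℕ v) (toℕ w) → slotOr f (toℕ w) ≡ slot f
    cycle-slot w (inj₁ (_ , w<M , _)) = slotOr-cycle f (toℕ w) w<M
    cycle-slot w (inj₂ (w<M , _ , _)) = slotOr-cycle f (toℕ w) w<M
    -- a conflicting flag sharing the slot of f would be f, which is not full
    not-f : ∀ w → FlagEdge (toℕ v) (toℕ w) → full C v w ≡ true → slot (toℕ w) ≢ slot f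
    not-f w fl w-full same = true≢false (trans (sym w-full) (subst (λ x → full C x w ≡ false)
      (vertex-toℕ v) (subst (λ y → full C (vertex (toℕ v)) y ≡ false) w-is-f not-full)))
      where
      w-is-f : vertex f ≡ w
      w-is-f = trans (cong vertex (sym (slot-injective fl flf same))) (vertex-toℕ w)
    distinct : ∀ w w' → Conflict C (colour start) v w → Conflict C (colour start) v w' →
      slotOr f (toℕ w) ≡ slotOr f (toℕ w') → w ≡ w'
    distinct w w' cw cw' same
      with conflict-at-cycle-vertex start v w v<M cw | conflict-at-cycle-vertex start v w' v<M cw'
    ... | inj₁ (fl , _) | inj₁ (fl' , _) =
      toℕ-injective (slot-injective fl fl' (trans (sym (flag-slot w fl)) (trans same (flag-slot w' fl'))))
    ... | inj₁ (fl , w-full) | inj₂ adj' =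
      ⊥-elim (not-f w fl w-full (trans (sym (flag-slot w fl)) (trans same (cycle-slot w' adj'))))
    ... | inj₂ adj | inj₁ (fl' , w'-full) =
      ⊥-elim (not-f w' fl' w'-full (trans (sym (flag-slot w' fl')) (trans (sym same) (cycle-slot w adj))))
    ... | inj₂ adj | inj₂ adj' = toℕ-injective (trans (only-p w adj cw) (sym (only-p w' adj' cw')))

  -- an odd cycle vertex carries no flags, so it has at most one conflict when
  -- it conflicts along the cycle with one vertex p only
  odd-degree : ∀ start v r (p : ℕ) → toℕ v < M → toℕ v ≡ suc (2 * r) →
    (∀ w → CycleAdjacent (toℕ v) (toℕ w) → Conflict C (colour start) v w → toℕ w ≡ p) →
    degφ C (colour start) v ≤ i
  odd-degree start v r p v<M odd only-p = single-conflict-degree start v p only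
    where
    only : ∀ w → Conflict C (colour start) v w → toℕ w ≡ p
    only w cw with conflict-at-cycle-vertex start v w v<M cw
    ... | inj₁ ((_ , _ , v≡att) , _) = ⊥-elim (even≢odd ((toℕ w ∸ M) / i) r (trans (sym v≡att) odd))
    ... | inj₂ adj = only-p w adj cw

  -- A conflict between adjacent cycle vertices is a conflict on the cycle
  -- edge, read in the direction of the cycle; so any symmetric relation
  -- containing the oriented conflicts contains it.
  as-cycle-conflict : ∀ start v w → toℕ v < M → toℕ w < M →
    E C v (colour start v) w (colour start w) ≡ true → CycleConflict start (toℕ v) (toℕ w)
  as-cycle-conflict start v w v<M w<M vw = begin
    E C (vertex (toℕ v)) (cycleColour start (toℕ v)) (vertex (toℕ w)) (cycleColour start (toℕ w))
      ≡⟨ cong₂ (λ x y → E C x (cycleColour start (toℕ v)) y (cycleColour start (toℕ w)))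
               (vertex-toℕ v) (vertex-toℕ w) ⟩
    E C v (cycleColour start (toℕ v)) w (cycleColour start (toℕ w))
      ≡⟨ cong₂ (λ α β → E C v α w β) (sym (colour-cycle start v v<M)) (sym (colour-cycle start w w<M)) ⟩
    E C v (colour start v) w (colour start w)
      ≡⟨ vw ⟩
    true
      ∎
    where open ≡-Reasoning

  cycle-conflicts-within : ∀ start (R : ℕ → ℕ → Set) → (∀ {a b} → R a b → R b a) →
    (∀ a b → CycleEdge a b → CycleConflict start a b → R a b) →
    ∀ v w → CycleAdjacent (toℕ v) (toℕ w) → Conflict C (colour start) v w → R (toℕ v) (toℕ w)
  cycle-conflicts-within start R R-sym conflicts⊆R v w (inj₁ cyc@(v<M , w<M , _)) (_ , vw) =
    conflicts⊆R _ _ cyc (as-cycle-conflict start v w v<M w<M vw)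
  cycle-conflicts-within start R R-sym conflicts⊆R v w (inj₂ cyc@(w<M , v<M , _)) (_ , vw) =
    R-sym (conflicts⊆R _ _ cyc
      (as-cycle-conflict start w v w<M v<M (trans (E-sym C w (colour start w) v (colour start v)) vw)))

  ConflictFree : ℕ → Set
  ConflictFree start = ∀ a b → CycleEdge a b → ¬ CycleConflict start a b

  conflict-free-colouring : ∀ start → ConflictFree start → HasIIColoring i C
  conflict-free-colouring start free = colour start , degree-ok
    where
    degree-ok : IsIIColoring i C (colour start)
    degree-ok v with M ≤? toℕ v
    ... | yes M≤v = flag-degree start v M≤v
    ... | no M≰v  = cycle-degree-no-conflict start v (≰⇒> M≰v)
                      (cycle-conflicts-within start (λ _ _ → ⊥) (λ ()) free v)

  one-conflict-colouring : ∀ start t p r f → p ≡ suc (2 * r) → FlagEdge t f → f < N → NotFull t f →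
    (∀ a b → CycleEdge a b → CycleConflict start a b → Between p t a b) → HasIIColoring i C
  one-conflict-colouring start t p r f p-odd flf f<N not-full conflicts⊆pt = colour start , degree-ok
    where
    t≢p : t ≢ p
    t≢p t≡p = even≢odd ((f ∸ M) / i) r (trans (sym (proj₂ (proj₂ flf))) (trans t≡p p-odd))
    Between-sym : ∀ {a b} → Between p t a b → Between p t b a
    Between-sym (inj₁ (a≡p , b≡t)) = inj₂ (b≡t , a≡p)
    Between-sym (inj₂ (a≡t , b≡p)) = inj₁ (b≡p , a≡t)
    along-cycle : ∀ v w → CycleAdjacent (toℕ v) (toℕ w) → Conflict C (colour start) v w →
      Between p t (toℕ v) (toℕ w)
    along-cycle = cycle-conflicts-within start (Between p t) Between-sym conflicts⊆pt
    degree-ok : IsIIColoring i C (colour start)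
    degree-ok v with M ≤? toℕ v
    ... | yes M≤v = flag-degree start v M≤v
    ... | no M≰v with ≰⇒> M≰v | toℕ v ≟ t | toℕ v ≟ p
    ...   | v<M | yes v≡t | _ =
      cycle-degree-one-conflict start v f p v<M (subst (λ a → FlagEdge a f) (sym v≡t) flf) f<N
        (subst (λ a → NotFull a f) (sym v≡t) not-full)
        only-p
      where
      only-p : ∀ w → CycleAdjacent (toℕ v) (toℕ w) → Conflict C (colour start) v w → toℕ w ≡ p
      only-p w adj cw with along-cycle v w adj cw
      ... | inj₁ (v≡p , _) = ⊥-elim (t≢p (trans (sym v≡t) v≡p))
      ... | inj₂ (_ , w≡p) = w≡p
    ...   | v<M | no v≢t | yes v≡p = odd-degree start v r t v<M (trans v≡p p-odd) only-t
      where
      only-t : ∀ w → CycleAdjacent (toℕ v) (toℕ w) → Conflict C (colour start) v w → toℕ w ≡ t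
      only-t w adj cw with along-cycle v w adj cw
      ... | inj₁ (_ , w≡t) = w≡t
      ... | inj₂ (v≡t , _) = ⊥-elim (v≢t v≡t)
    ...   | v<M | no v≢t | no v≢p = cycle-degree-no-conflict start v v<M none
      where
      none : ∀ w → CycleAdjacent (toℕ v) (toℕ w) → ¬ Conflict C (colour start) v w
      none w adj cw with along-cycle v w adj cw
      ... | inj₁ (v≡p , _) = v≢p v≡p
      ... | inj₂ (v≡t , _) = v≢t v≡t

  unflipped-conflicts-on-wrap : (∀ a b → CycleEdge a b → NotFull a b) →
    ∀ a b → CycleEdge a b → CycleConflict M a b → a ≡ top × b ≡ 0
  unflipped-conflicts-on-wrap not-full a .(suc a) cyc@(_ , sa<M , inj₁ refl) conflict =
    ⊥-elim (<-irrefl (forward-conflict M a cyc (not-full _ _ cyc) conflict) sa<M)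
  unflipped-conflicts-on-wrap not-full a .0 (_ , _ , inj₂ (sa≡M , refl)) conflict =
    suc-injective sa≡M , refl

  greedy-conflict-free : (∀ a b → CycleEdge a b → NotFull a b) → wrapConflict ≡ false → ConflictFree M
  greedy-conflict-free not-full no-wrap a b cyc conflict
    with unflipped-conflicts-on-wrap not-full a b cyc conflict
  ... | refl , refl with wrap-conflict top (not-full _ _ wrapEdge) conflict
  ...   | inj₁ (_ , greedy) = true≢false (trans (sym greedy) no-wrap)
  ...   | inj₂ (M≤top , _)  = <-irrefl refl M≤top

  DeficientAt : ℕ → ℕ → Set
  DeficientAt a b = matchingCount C (vertex a) (vertex b) < mG a b

  deficient-at : ∀ x y → x ≢ y → matchingCount C x y < mult G x y → DeficientAt (toℕ x) (toℕ y)
  deficient-at x y x≢y fewer =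
    subst₂ _<_ (cong₂ (matchingCount C) (sym (vertex-toℕ x)) (sym (vertex-toℕ y))) (mult-toℕ x y x≢y) fewer

  deficient-edge : Deficient G C →
    (Σ ℕ λ a → Σ ℕ λ b → CycleEdge a b × DeficientAt a b) ⊎
    (Σ ℕ λ a → Σ ℕ λ b → FlagEdge a b × b < N × DeficientAt a b)
  deficient-edge (x , y , x≢y , fewer) with adjacent x y x≢y (≤-trans (s≤s z≤n) fewer)
  ... | inj₁ cyc              = inj₁ (_ , _ , cyc , deficient-at x y x≢y fewer)
  ... | inj₂ (inj₁ cyc)       = inj₁ (_ , _ , cyc , deficient-at y x y≢x fewer-yx)
    where
    y≢x = λ y≡x → x≢y (sym y≡x)
    fewer-yx = subst₂ _<_ (sym (matchingCount-sym C x≢y)) (mult-sym G x y) fewer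
  ... | inj₂ (inj₂ (inj₁ fl)) = inj₂ (_ , _ , fl , toℕ<n y , deficient-at x y x≢y fewer)
  ... | inj₂ (inj₂ (inj₂ fl)) = inj₂ (_ , _ , fl , toℕ<n x , deficient-at y x y≢x fewer-yx)
    where
    y≢x = λ y≡x → x≢y (sym y≡x)
    fewer-yx = subst₂ _<_ (sym (matchingCount-sym C x≢y)) (mult-sym G x y) fewer

  deficient-flag-not-full : ∀ {a b} → FlagEdge a b → DeficientAt a b → NotFull a b
  deficient-flag-not-full {a} {b} fl fewer =
    not-full-by-count C _ _ (≤-pred (subst (matchingCount C (vertex a) (vertex b) <_) (flag-mult≡2 fl) fewer))

-- Deficient covers of G_m are colourable, for m ≥ 2.  Here every cycle edge
-- is simple, so it carries at most one matching, and none if deficient.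

module LongCycle (k m'' : ℕ) (C : Cover (Gm (suc k) (suc (suc m'')))) where

  open Structure k (suc m'')
  open Colouring k (suc m'') C

  cycle-not-full : ∀ a b → CycleEdge a b → NotFull a b
  cycle-not-full a b cyc = not-full-by-count C _ _ (subst (matchingCount C (vertex a) (vertex b) ≤_)
      (trans (mult-vertex a<N b<N (CycleEdge-≢ cyc)) (cycle-mult≡1 (s≤s (s≤s z≤n)) cyc))
      (matchingCount≤mult C _ _ (cycle-≢ cyc)))
    where
    a<N = proj₁ (CycleEdge<N cyc)
    b<N = proj₂ (CycleEdge<N cyc)

  deficient-cycle-empty : ∀ {a b} → CycleEdge a b → DeficientAt a b → ∀ start → ¬ CycleConflict start a b
  deficient-cycle-empty {a} {b} cyc fewer start conflict =
    true≢false (trans (sym conflict) (empty-by-count C _ _ (cycle-≢ cyc)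
      (subst (matchingCount C (vertex a) (vertex b) <_) (cycle-mult≡1 (s≤s (s≤s z≤n)) cyc) fewer) _ _))

  -- A deficient edge v_a v_{a+1}: if the greedy colouring conflicts on the
  -- wrap edge, flip from a+1 on, which moves that conflict onto the empty edge.
  forward-deficient : ∀ a → (cyc : CycleEdge a (suc a)) → DeficientAt a (suc a) → HasIIColoring i C
  forward-deficient a cyc@(_ , sa<M , _) fewer with wrapConflict in greedy
  ... | false = conflict-free-colouring M (greedy-conflict-free cycle-not-full greedy)
  ... | true  = conflict-free-colouring (suc a) free
    where
    free : ConflictFree (suc a)
    free b .(suc b) cyc'@(_ , _ , inj₁ refl) conflict
      with suc-injective (forward-conflict (suc a) b cyc' (cycle-not-full _ _ cyc') conflict)
    ... | refl = deficient-cycle-empty cyc fewer (suc a) conflict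
    free b .0 (_ , _ , inj₂ (sb≡M , refl)) conflict with suc-injective sb≡M
    ... | refl with wrap-conflict a (cycle-not-full _ _ wrapEdge) conflict
    ...   | inj₁ (top<sa , _)  = <⇒≱ top<sa (≤-pred sa<M)
    ...   | inj₂ (_ , no-wrap) = true≢false (trans (sym greedy) no-wrap)

  -- A deficient wrap edge: without flipping, the wrap edge is the only
  -- possible conflict, and it is empty.
  wrap-deficient : DeficientAt top 0 → HasIIColoring i C
  wrap-deficient fewer = conflict-free-colouring M free
    where
    free : ConflictFree M
    free a b cyc conflict with unflipped-conflicts-on-wrap cycle-not-full a b cyc conflict
    ... | refl , refl = deficient-cycle-empty wrapEdge fewer M conflict

  -- A flag f at v_{2h} with a single matching: v_{2h} may take one conflict,
  -- with v_{2h-1} (flip from 2h on), or for h = 0 with v_{M-1} (no flip).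
  flag-deficient : ∀ h f → FlagEdge (2 * h) f → f < N → NotFull (2 * h) f → HasIIColoring i C
  flag-deficient h f fl f<N not-full with wrapConflict in greedy
  ... | false = conflict-free-colouring M (greedy-conflict-free cycle-not-full greedy)
  flag-deficient zero f fl f<N not-full | true =
    one-conflict-colouring M 0 top (suc m'') f (+-suc (suc m'') (suc m'' + 0)) fl f<N not-full on-wrap
    where
    on-wrap : ∀ a b → CycleEdge a b → CycleConflict M a b → Between top 0 a b
    on-wrap a b cyc conflict = inj₁ (unflipped-conflicts-on-wrap cycle-not-full a b cyc conflict)
  flag-deficient (suc h) f fl@(2h<M , _) f<N not-full | true =
    one-conflict-colouring (2 * suc h) (2 * suc h) (suc (2 * h)) h f refl fl f<N not-full before-2h
    where
    before-2h : ∀ a b → CycleEdge a b → CycleConflict (2 * suc h) a b →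
      Between (suc (2 * h)) (2 * suc h) a b
    before-2h a .(suc a) cyc@(_ , _ , inj₁ refl) conflict =
      inj₁ (suc-injective (trans at-start (*-suc 2 h)) , at-start)
      where
      at-start = forward-conflict (2 * suc h) a cyc (cycle-not-full _ _ cyc) conflict
    before-2h a .0 (_ , _ , inj₂ (sa≡M , refl)) conflict with suc-injective sa≡M
    ... | refl with wrap-conflict (h + suc (h + 0)) (cycle-not-full _ _ wrapEdge) conflict
    ...   | inj₁ (top<2h , _)  = ⊥-elim (<⇒≱ top<2h (≤-pred 2h<M))
    ...   | inj₂ (_ , no-wrap) = ⊥-elim (true≢false (trans (sym greedy) no-wrap))

  deficient-colourable : Deficient G C → HasIIColoring i C
  deficient-colourable deficient with deficient-edge deficient
  ... | inj₁ (a , .(suc a) , cyc@(_ , _ , inj₁ refl) , fewer) = forward-deficient a cyc fewer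
  ... | inj₁ (a , .0 , (_ , _ , inj₂ (sa≡M , refl)) , fewer) with suc-injective sa≡M
  ...   | refl = wrap-deficient fewer
  deficient-colourable deficient | inj₂ (a , f , fl@(_ , _ , a≡2h) , f<N , fewer) with a≡2h
  ... | refl = flag-deficient ((f ∸ M) / i) f fl f<N (deficient-flag-not-full fl fewer)

-- Deficient covers of G_1 are colourable.  The cycle is the double edge
-- v_0 v_1, met twice: as the edge (0,1) and as the wrap edge (1,0).

module ShortCycle (k : ℕ) (C : Cover (Gm (suc k) 1)) where

  open Structure k 0
  open Colouring k 0 C

  cycle-edges : ∀ {a b} → CycleEdge a b → Between 0 1 a b
  cycle-edges {zero}          (_ , _ , inj₁ refl)            = inj₁ (refl , refl)
  cycle-edges {zero}          (_ , _ , inj₂ (() , _))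
  cycle-edges {suc zero}      (_ , s≤s (s≤s ()) , inj₁ refl)
  cycle-edges {suc zero}      (_ , _ , inj₂ (_ , refl))      = inj₂ (refl , refl)
  cycle-edges {suc (suc a)}   (s≤s (s≤s ()) , _)

  -- A deficient cycle edge makes the double edge single; then the greedy
  -- colouring avoids the edge in both of its readings.
  cycle-deficient : ∀ {a b} → CycleEdge a b → DeficientAt a b → HasIIColoring i C
  cycle-deficient cyc fewer = conflict-free-colouring M (greedy-conflict-free not-full no-wrap)
    where
    0→1 : CycleEdge 0 1
    0→1 = s≤s z≤n , s≤s (s≤s z≤n) , inj₁ refl
    0≢1 : vertex 0 ≢ vertex 1
    0≢1 = cycle-≢ 0→1
    single-01 : NotFull 0 1
    single-01 with cycle-edges cyc
    ... | inj₁ (refl , refl) = not-full-by-count C _ _ (≤-pred fewer)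
    ... | inj₂ (refl , refl) = trans (sym (full-sym C 0≢1)) (not-full-by-count C _ _ (≤-pred fewer))
    not-full : ∀ a b → CycleEdge a b → NotFull a b
    not-full a b cyc' with cycle-edges cyc'
    ... | inj₁ (refl , refl) = single-01
    ... | inj₂ (refl , refl) = trans (full-sym C 0≢1) single-01
    no-wrap : wrapConflict ≡ false
    no-wrap = trans (E-sym C (vertex 1) (greedy 1) (vertex 0) false) (greedy-avoids 0 0→1 single-01)

  -- A deficient flag at v_0 lets v_0 take its conflict with v_1.
  flag-deficient : ∀ f → FlagEdge 0 f → f < N → NotFull 0 f → HasIIColoring i C
  flag-deficient f fl f<N not-full =
    one-conflict-colouring M 0 1 0 f refl fl f<N not-full (λ a b cyc _ → swap (cycle-edges cyc))
    where
    swap : ∀ {a b} → Between 0 1 a b → Between 1 0 a b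
    swap (inj₁ ab) = inj₂ ab
    swap (inj₂ ab) = inj₁ ab

  deficient-colourable : Deficient G C → HasIIColoring i C
  deficient-colourable deficient with deficient-edge deficient
  ... | inj₁ (_ , _ , cyc , fewer) = cycle-deficient cyc fewer
  ... | inj₂ (a , f , fl@(a<2 , _ , a≡2h) , f<N , fewer) with a≡0 {h = (f ∸ M) / i} a<2 a≡2h
    where
    a≡0 : ∀ {a h} → a < 2 → a ≡ 2 * h → a ≡ 0
    a≡0 {h = zero} _ a≡2h = a≡2h
    a≡0 {h = suc h} a<2 refl = ⊥-elim (<⇒≱ a<2 (*-monoʳ-≤ 2 {1} {suc h} (s≤s z≤n)))
  ... | refl = flag-deficient f fl f<N (deficient-flag-not-full fl fewer)

-- Over a double edge it takes both matchings;
-- over a simple edge the crossed matching, except the straight matching over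
-- v_0 v_1.  Every flag at an even vertex v_{2h} then conflicts with it, so
-- v_{2h} already has i conflicts and no cycle edge (each has an even end) may
-- conflict.  For m = 1 the double edge v_0 v_1 always conflicts; for m ≥ 2
-- the crossed edges force equal colours all around v_1 … v_{M-1} v_0 while
-- the straight edge forces v_0 and v_1 to differ.

module BadCover (k m' : ℕ) where

  open Structure k m'

  badStraight badCrossed : ℕ → Bool → Bool
  badStraight zero          _       = false
  badStraight (suc zero)    special = special
  badStraight (suc (suc _)) _       = true
  badCrossed  zero          _       = false
  badCrossed  (suc zero)    special = not special
  badCrossed  (suc (suc _)) _       = true

  bad-bits≤ : ∀ n special → boolToℕ (badStraight n special) + boolToℕ (badCrossed n special) ≤ n
  bad-bits≤ zero          _     = z≤n
  bad-bits≤ (suc zero)    false = s≤s z≤n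
  bad-bits≤ (suc zero)    true  = s≤s z≤n
  bad-bits≤ (suc (suc n)) _     = s≤s (s≤s z≤n)

  -- the pair v_0 v_1
  special : Fin N → Fin N → Bool
  special x y = does (toℕ x + toℕ y ≟ 1)

  badMatching : Fin N → Fin N → Bool → Bool → Bool
  badMatching x y =
    matching (badStraight (mult G x y) (special x y)) (badCrossed (mult G x y) (special x y))

  badBy : (x y : Fin N) → Dec (x ≡ y) → Bool → Bool → Bool
  badBy x y (yes _) a b = not (a == b)
  badBy x y (no _)  a b = badMatching x y a b

  badE : Fin N → Bool → Fin N → Bool → Bool
  badE x a y b = badBy x y (x ≟ᶠ y) a b

  -- (the case splits go through badBy: splitting on x ≟ y directly would
  -- also rewrite the multiplicity mult G x y, which is defined by that split)
  badE-distinct : ∀ x y → x ≢ y → ∀ a b → badE x a y b ≡ badMatching x y a b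
  badE-distinct x y x≢y a b = distinct (x ≟ᶠ y)
    where
    distinct : (d : Dec (x ≡ y)) → badBy x y d a b ≡ badMatching x y a b
    distinct (yes x≡y) = ⊥-elim (x≢y x≡y)
    distinct (no _)    = refl

  badE-sym : ∀ x a y b → badE x a y b ≡ badE y b x a
  badE-sym x a y b = symmetric (x ≟ᶠ y) (y ≟ᶠ x)
    where
    symmetric : (d : Dec (x ≡ y)) (d' : Dec (y ≡ x)) → badBy x y d a b ≡ badBy y x d' b a
    symmetric (yes _)  (yes _)  = cong not (==-sym a b)
    symmetric (yes xy) (no ¬yx) = ⊥-elim (¬yx (sym xy))
    symmetric (no ¬xy) (yes yx) = ⊥-elim (¬xy (sym yx))
    symmetric (no _)   (no _)   = trans
      (cong₂ (λ n sp → matching (badStraight n sp) (badCrossed n sp) a b)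
        (mult-sym G x y) (cong (λ z → does (z ≟ 1)) (+-comm (toℕ x) (toℕ y))))
      (matching-sym (badStraight (mult G y x) (special y x)) (badCrossed (mult G y x) (special y x)) a b)

  badE-inside : ∀ x a b → badE x a x b ≡ not (a == b)
  badE-inside x a b = inside (x ≟ᶠ x)
    where
    inside : (d : Dec (x ≡ x)) → badBy x x d a b ≡ not (a == b)
    inside (yes _)  = refl
    inside (no ¬xx) = ⊥-elim (¬xx refl)

  badCover : Cover G
  badCover = record
    { E = badE ; E-sym = badE-sym ; E-inside = badE-inside
    ; E-between = λ x y x≢y →
        badStraight (mult G x y) (special x y) , badCrossed (mult G x y) (special x y) ,
        bad-bits≤ (mult G x y) (special x y) , badE-distinct x y x≢y }

  badE-double : ∀ {a b} → a < N → b < N → a ≢ b → mG a b ≡ 2 →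
    ∀ α β → badE (vertex a) α (vertex b) β ≡ true
  badE-double {a} {b} a<N b<N a≢b double α β =
    trans (badE-distinct _ _ (vertex-≢ a<N b<N a≢b) α β)
      (trans (cong (λ n → matching (badStraight n sp) (badCrossed n sp) α β)
                   (trans (mult-vertex a<N b<N a≢b) double))
             (matching-full α β))
    where sp = special (vertex a) (vertex b)

  flag : ℕ → ℕ → ℕ
  flag h j = M + (h * i + j)

  flag<N : ∀ h j → h < m → j < i → flag h j < N
  flag<N h j h<m j<i = +-monoʳ-< M (begin-strict
    h * i + j   <⟨ +-monoʳ-< (h * i) j<i ⟩
    h * i + i   ≡⟨ +-comm (h * i) i ⟩
    suc h * i   ≤⟨ *-monoˡ-≤ i h<m ⟩
    m * i       ∎)
    where open ≤-Reasoning

  attach-flag : ∀ h j → j < i → attach (flag h j) ≡ 2 * h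
  attach-flag h j j<i = cong (2 *_) (begin
    (M + (h * i + j) ∸ M) / i  ≡⟨ cong (_/ i) (m+n∸m≡n M (h * i + j)) ⟩
    (h * i + j) / i            ≡⟨ +-distrib-/-∣ˡ j (divides h refl) ⟩
    h * i / i + j / i          ≡⟨ cong₂ _+_ (m*n/n≡m h i) (m<n⇒m/n≡0 j<i) ⟩
    h + 0                      ≡⟨ +-identityʳ h ⟩
    h                          ∎)
    where open ≡-Reasoning

  flag-edge : ∀ h j → h < m → j < i → FlagEdge (2 * h) (flag h j)
  flag-edge h j h<m j<i = *-monoʳ-< 2 h<m , m≤m+n M _ , sym (attach-flag h j j<i)

  -- In a colouring of the bad cover no cycle edge at an even vertex conflicts:
  -- together with its i flags v_{2h} would have i + 1 conflicts.
  even-vertex-saturated : ∀ φ → IsIIColoring i badCover φ → ∀ h → h < m → ∀ (w : Fin N) →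
    CycleAdjacent (2 * h) (toℕ w) → badE (vertex (2 * h)) (φ (vertex (2 * h))) w (φ w) ≡ true → ⊥
  even-vertex-saturated φ φ-ok h h<m w adj vw =
    ≤⇒≯ (φ-ok v) (degree≥ badCover φ v ι conflicts injective)
    where
    2h<M = *-monoʳ-< 2 h<m
    v = vertex (2 * h)
    toℕ-v : toℕ v ≡ 2 * h
    toℕ-v = toℕ-vertex (<M⇒<N 2h<M)
    w<M : toℕ w < M
    w<M = [ (λ cyc → proj₁ (proj₂ cyc)) , proj₁ ]′ adj
    w≢v : w ≢ v
    w≢v w≡v = [ (λ cyc → CycleEdge-≢ cyc (sym w≡2h)) , (λ cyc → CycleEdge-≢ cyc w≡2h) ]′ adj
      where w≡2h = trans (cong toℕ w≡v) toℕ-v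
    ι : Fin (suc i) → Fin N
    ι zero    = w
    ι (suc j) = vertex (flag h (toℕ j))
    toℕ-flag : ∀ (j : Fin i) → toℕ (vertex (flag h (toℕ j))) ≡ flag h (toℕ j)
    toℕ-flag j = toℕ-vertex (flag<N h (toℕ j) h<m (toℕ<n j))
    flag≢v : ∀ (j : Fin i) → vertex (flag h (toℕ j)) ≢ v
    flag≢v j fl≡v = ≤⇒≯ (subst (M ≤_) (sym (toℕ-flag j)) (m≤m+n M _))
                        (subst (_< M) (sym (trans (cong toℕ fl≡v) toℕ-v)) 2h<M)
    conflicts : ∀ j → Conflict badCover φ v (ι j)
    conflicts zero    = w≢v , vw
    conflicts (suc j) = flag≢v j , badE-double (<M⇒<N 2h<M) (flag<N h (toℕ j) h<m (toℕ<n j))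
      (λ 2h≡fl → <-irrefl 2h≡fl (≤-trans 2h<M (m≤m+n M _)))
      (flag-mult≡2 (flag-edge h (toℕ j) h<m (toℕ<n j))) _ _
    injective : ∀ j j' → ι j ≡ ι j' → j ≡ j'
    injective zero    zero    _ = refl
    injective zero    (suc j) w≡fl = ⊥-elim (≤⇒≯ (subst (M ≤_) (sym (toℕ-flag j)) (m≤m+n M _))
                                                 (subst (_< M) (cong toℕ w≡fl) w<M))
    injective (suc j) zero    fl≡w = ⊥-elim (≤⇒≯ (subst (M ≤_) (sym (toℕ-flag j)) (m≤m+n M _))
                                                 (subst (_< M) (cong toℕ (sym fl≡w)) w<M))
    injective (suc j) (suc j') fl≡fl' = cong suc (toℕ-injective
      (+-cancelˡ-≡ (h * i) _ _ (+-cancelˡ-≡ M _ _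
        (trans (sym (toℕ-flag j)) (trans (cong toℕ fl≡fl') (toℕ-flag j'))))))

  even-end-silent : ∀ φ → IsIIColoring i badCover φ → ∀ h c → CycleAdjacent (2 * h) c →
    badE (vertex (2 * h)) (φ (vertex (2 * h))) (vertex c) (φ (vertex c)) ≡ false
  even-end-silent φ φ-ok h c adj =
    ¬-not (even-vertex-saturated φ φ-ok h h<m (vertex c)
                   (subst (CycleAdjacent (2 * h)) (sym (toℕ-vertex c<N)) adj))
    where
    2h<M : 2 * h < M
    2h<M = [ proj₁ , (λ cyc → proj₁ (proj₂ cyc)) ]′ adj
    h<m = *-cancelˡ-< 2 h m 2h<M
    c<N : c < N
    c<N = <M⇒<N ([ (λ cyc → proj₁ (proj₂ cyc)) , proj₁ ]′ adj)

  -- every cycle edge has an even end, hence carries no conflict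
  cycle-edge-silent : ∀ φ → IsIIColoring i badCover φ → ∀ a b → CycleEdge a b →
    badE (vertex a) (φ (vertex a)) (vertex b) (φ (vertex b)) ≡ false
  cycle-edge-silent φ φ-ok a b cyc with even-or-odd a
  ... | inj₁ (h , refl) = even-end-silent φ φ-ok h b (inj₁ cyc)
  ... | inj₂ (h , a-odd) with b-even cyc
    where
    b-even : CycleEdge a b → Σ ℕ λ h' → b ≡ 2 * h'
    b-even (_ , _ , inj₁ refl)      = suc h , trans (cong suc a-odd) (sym (*-suc 2 h))
    b-even (_ , _ , inj₂ (_ , refl)) = 0 , refl
  ...   | h' , refl = trans (badE-sym (vertex a) (φ (vertex a)) (vertex (2 * h')) (φ (vertex (2 * h'))))
                          (even-end-silent φ φ-ok h' a (inj₂ cyc))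

  -- m = 1: the cycle edge v_0 v_1 is double, so it always conflicts
  double-cycle-uncolourable : mG 0 1 ≡ 2 → ¬ HasIIColoring i badCover
  double-cycle-uncolourable double (φ , φ-ok) =
    true≢false (trans (sym always) (cycle-edge-silent φ φ-ok 0 1 0→1))
    where
    0→1 : CycleEdge 0 1
    0→1 = s≤s z≤n , ≤-trans (s≤s (s≤s z≤n)) M≥2 , inj₁ refl
    always = badE-double (proj₁ (CycleEdge<N 0→1)) (proj₂ (CycleEdge<N 0→1)) (λ ()) double _ _

  badE-simple : 2 ≤ m → ∀ {a b} → CycleEdge a b → ∀ α β →
    badE (vertex a) α (vertex b) β ≡ matching (does (a + b ≟ 1)) (not (does (a + b ≟ 1))) α β
  badE-simple m≥2 {a} {b} cyc α β =
    trans (badE-distinct _ _ (vertex-≢ a<N b<N (CycleEdge-≢ cyc)) α β)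
      (cong₂ (λ n sp → matching (badStraight n sp) (badCrossed n sp) α β)
        (trans (mult-vertex a<N b<N (CycleEdge-≢ cyc)) (cycle-mult≡1 m≥2 cyc))
        (cong₂ (λ x y → does (x + y ≟ 1)) (toℕ-vertex a<N) (toℕ-vertex b<N)))
    where
    a<N = proj₁ (CycleEdge<N cyc)
    b<N = proj₂ (CycleEdge<N cyc)

  simple-cycle-uncolourable : 2 ≤ m → ¬ HasIIColoring i badCover
  simple-cycle-uncolourable m≥2 (φ , φ-ok) =
    v₀≢v₁ (trans (sym top≡0) (around top (≤-trans (s≤s z≤n) 3≤top) ≤-refl))
    where
    ψ : ℕ → Bool
    ψ a = φ (vertex a)
    silent : ∀ {a b} → CycleEdge a b →
      matching (does (a + b ≟ 1)) (not (does (a + b ≟ 1))) (ψ a) (ψ b) ≡ false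
    silent {a} {b} cyc = trans (sym (badE-simple m≥2 cyc (ψ a) (ψ b))) (cycle-edge-silent φ φ-ok a b cyc)
    crossed-equal : ∀ {a b} → CycleEdge a b → a + b ≢ 1 → ψ a ≡ ψ b
    crossed-equal {a} {b} cyc a+b≢1 = crossed-absent⇒equal (ψ a) (ψ b)
      (subst (λ sp → matching sp (not sp) (ψ a) (ψ b) ≡ false) (dec-false (a + b ≟ 1) a+b≢1) (silent cyc))
    3≤top : 3 ≤ top
    3≤top = ≤-pred (M≥4 m≥2)
    around : ∀ j → 1 ≤ j → j < M → ψ j ≡ ψ 1
    around (suc zero)    _ _       = refl
    around (suc (suc j)) _ ssj<M = trans
      (sym (crossed-equal (<⇒≤ ssj<M , ssj<M , inj₁ refl)
        (λ sum≡1 → <-irrefl (sym sum≡1) (s≤s (subst (1 ≤_) (sym (+-suc j (suc j))) (s≤s z≤n))))))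
      (around (suc j) (s≤s z≤n) (<⇒≤ ssj<M))
    top≡0 : ψ top ≡ ψ 0
    top≡0 = crossed-equal wrapEdge
      (λ sum≡1 → <-irrefl (sym (trans (sym (+-identityʳ top)) sum≡1)) (≤-trans (s≤s (s≤s z≤n)) 3≤top))
    v₀≢v₁ : ψ 0 ≢ ψ 1
    v₀≢v₁ = straight-absent⇒different (ψ 0) (ψ 1)
              (silent (s≤s z≤n , ≤-trans (s≤s (s≤s z≤n)) M≥2 , inj₁ refl))

proposition10p9 : ∀ (i m : ℕ) (i≥1 : 1 ≤ i) → 1 ≤ m →
    IICritical i (Gm i m {{>-nonZero i≥1}})
proposition10p9 (suc k) (suc zero) (s≤s z≤n) (s≤s z≤n) =
  (BadCover.badCover k 0 , BadCover.double-cycle-uncolourable k 0 refl) ,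
  proper-subgraphs-colourable (suc k) (Gm (suc k) 1)
    (ShortCycle.deficient-colourable k) (Structure.has-neighbour k 0)
proposition10p9 (suc k) (suc (suc m'')) (s≤s z≤n) (s≤s z≤n) =
  (BadCover.badCover k (suc m'') , BadCover.simple-cycle-uncolourable k (suc m'') (s≤s (s≤s z≤n))) ,
  proper-subgraphs-colourable (suc k) (Gm (suc k) (suc (suc m'')))
    (LongCycle.deficient-colourable k m'') (Structure.has-neighbour k (suc m''))
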